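{- Let $a,k,b\ge 2$ be integers and $d$ a positive integer with $\gcd(a,d)=1$, and let $$A=\left(a,\ ba+d,\ b^2a+\frac{b^2-1}{b-1}d,\ \ldots,\ b^ka+\frac{b^k-1}{b-1}d\right).$$ Let $p$ be a positive divisor of $a$ with $p\ne a$. If $a\ge k-1-\frac{d-1}{b-1}$, then $$g\left(\frac{\langle A\rangle}{p}\right)=\sum_{r=1}^{\frac{a}{p}-1}\left(\sum_{i=1}^k x_i\right)_{rp}+\frac{(b-1)a+d-1}{2}\left(\frac{a}{p}-1\right),$$ where $\left(\sum_{i=1}^k x_i\right)_{rp}$ denotes $x_1+\cdots+x_k$ for the greedy presentation $X(rp)=(x_1,\dots,x_k)$ of $rp$ with respect to $B=(b_1,\dots,b_k)$, $b_i=\frac{b^i-1}{b-1}$.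
   Context: $\langle A\rangle$ is the set of non-negative integer linear combinations of the entries of $A$, and $\frac{\langle A\rangle}{p}=\{x\in\mathbb{N}\mid px\in\langle A\rangle\}$ (with $\mathbb{N}$ the non-negative integers), a numerical semigroup. $g(S)$ is the number of positive integers not in the numerical semigroup $S$. Here $b_1=1$ and $b_{i+1}=bb_i+1$. Greedy presentation: for $M\in\mathbb{N}$ there is a unique tuple $X(M)=(x_1,\dots,x_k)\in\mathbb{N}^k$ with $\sum_i b_ix_i=M$ such that (1) $x_k=\lfloor M/b_k\rfloor$; (2) $x_i\in\{0,1,\dots,b\}$ for $1\le i\le k-1$; (3) if $x_i=b$ for some $2\le i\le k-1$ then $x_1=\cdots=x_{i-1}=0$. -}

module Defs where

open import Data.Nat using (ℕ; zero; suc; _+_; _*_; _∸_; _^_; _≤_; _<_; _/_)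
open import Data.Nat.ListAction using (sum)
open import Data.Fin using (Fin; toℕ)
open import Data.List using (List; tabulate; applyUpTo; length; map)
open import Data.List.Membership.Propositional using (_∈_)
open import Data.List.Relation.Unary.Unique.Propositional using (Unique)
open import Data.Product using (Σ; ∃; _×_)
open import Relation.Binary.PropositionalEquality using (_≡_)
open import Relation.Nullary using (¬_)
open import Function.Bundles using (_⇔_)

-- repunit in base b:  B b 0 = 0,  B b (i+1) = b * B b i + 1,
-- so B b i = (b^i - 1)/(b - 1) and B b i = b_i of the paper for i ≥ 1.
B : ℕ → ℕ → ℕ
B b zero    = zero
B b (suc i) = suc (b * B b i)

ΣFin : ∀ {n} → (Fin n → ℕ) → ℕ
ΣFin f = sum (tabulate f)

genA : (a b d k : ℕ) → Fin (suc k) → ℕ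
genA a b d k i = b ^ toℕ i * a + B b (toℕ i) * d

InSpan : ∀ {n} → (Fin n → ℕ) → ℕ → Set
InSpan {n} A x = Σ (Fin n → ℕ) λ c → ΣFin (λ i → c i * A i) ≡ x

InQuot : ∀ {n} → (Fin n → ℕ) → ℕ → ℕ → Set
InQuot A p x = InSpan A (p * x)

HasGenus : (ℕ → Set) → ℕ → Set
HasGenus S N = Σ (List ℕ) λ L →
  Unique L × (∀ x → (x ∈ L) ⇔ (0 < x × ¬ S x)) × length L ≡ N

-- Greedy presentation of M with respect to (b_1, ..., b_k).
-- x : Fin k → ℕ, where x i stands for x_{toℕ i + 1}, with weight b_{toℕ i + 1} = B b (suc (toℕ i)).
IsGreedy : (b k M : ℕ) → (Fin k → ℕ) → Set
IsGreedy b k M x =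
    ΣFin (λ i → B b (suc (toℕ i)) * x i) ≡ M
  × (∀ (i : Fin k) → suc (toℕ i) ≡ k → x i ≡ M / B b (suc (toℕ i)))
  × (∀ (i : Fin k) → suc (toℕ i) < k → x i ≤ b)
  × (∀ (i j : Fin k) → 1 ≤ toℕ i → suc (toℕ i) < k → x i ≡ b → toℕ j < toℕ i → x j ≡ 0)

Σ1to : ℕ → (ℕ → ℕ) → ℕ
Σ1to n f = sum (applyUpTo (λ r → f (suc r)) n)

-- With c = (b - 1) a + d the generators are c b_i + a (b_0 = 0), so ⟨A⟩ = {c M + a m | m ≥ h M}
-- where h M, the greedy digit sum of M, is the least number of b_i (1 ≤ i ≤ k) summing to M.
-- Put n = a / p. The hypothesis on a says (k - 1)(b - 1) + 1 ≤ c, so adding a to M lowers h by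
-- at most c; hence the Apéry set of ⟨A⟩/p with respect to n is {c r + n h(r p) | r < n}, which
-- meets every class mod n once since gcd(n, c) = 1. The genus is then the sum of the floors of
-- its elements divided by n, and the pairing r ↔ n - r gives Σ ⌊c r / n⌋ = (c - 1)(n - 1) / 2.

module Submission where

open import Defs
open import Data.Empty using (⊥-elim)
open import Data.Fin using (Fin; toℕ) renaming (zero to fzero; suc to fsuc)
open import Data.Fin.Properties using (toℕ≤pred[n])
open import Data.List using (List; []; [_]; _++_; applyUpTo; length)
open import Data.List.Properties using (applyUpTo-∷ʳ; length-++; length-applyUpTo; tabulate-cong)
open import Data.List.Membership.Propositional using (_∈_)
open import Data.List.Membership.Propositional.Properties using (∈-applyUpTo⁺; ∈-applyUpTo⁻; ∈-++⁺ˡ; ∈-++⁺ʳ; ∈-++⁻)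
import Data.List.Relation.Unary.AllPairs as AllPairs
open import Data.List.Relation.Unary.Unique.Propositional using (Unique)
import Data.List.Relation.Unary.Unique.Propositional.Properties as UniqueP
open import Data.Nat
open import Data.Nat.DivMod
open import Data.Nat.Divisibility using (_∣_; divides; divides-refl; ∣-trans; ∣m+n∣m⇒∣n; n∣m*n; m∣m*n; ∣⇒≤)
open import Data.Nat.Coprimality as Coprimality using (Coprime; coprime-Bézout; coprime-divisor; gcd≡1⇒coprime)
open import Data.Nat.GCD using (gcd; module Bézout)
open import Data.Nat.ListAction using (sum)
open import Data.Nat.ListAction.Properties using (sum-++)
open import Data.Nat.Properties
open import Algebra.Properties.CommutativeSemigroup +-commutativeSemigroup using (interchange)
open import Data.Nat.Tactic.RingSolver using (solve-∀)
open import Data.Product using (Σ; ∃-syntax; _×_; _,_; proj₁; proj₂)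
open import Data.Sum using (inj₁; inj₂)
open import Function using (_∘_)
open import Function.Bundles using (_⇔_; mk⇔; module Equivalence)
open import Relation.Binary.PropositionalEquality hiding ([_])
open import Relation.Nullary using (¬_; Dec; yes; no)

[m+kn]/n≡k : ∀ {m n} .{{_ : NonZero n}} k → m < n → (m + k * n) / n ≡ k
[m+kn]/n≡k {m} {n} k m<n = begin
  (m + k * n) / n    ≡⟨ +-distrib-/-∣ʳ m (divides-refl k) ⟩
  m / n + k * n / n  ≡⟨ cong₂ _+_ (m<n⇒m/n≡0 m<n) (m*n/n≡m k n) ⟩
  k                  ∎
  where open ≡-Reasoning

[m+kn]%n≡m : ∀ {m n} .{{_ : NonZero n}} k → m < n → (m + k * n) % n ≡ m
[m+kn]%n≡m {m} {n} k m<n = trans ([m+kn]%n≡m%n m k n) (m<n⇒m%n≡m m<n)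

≤∸1⇒< : ∀ {m n} .{{_ : NonZero n}} → m ≤ n ∸ 1 → m < n
≤∸1⇒< {n = suc _} = s≤s

<⇒≤∸1 : ∀ {m n} → m < n → m ≤ n ∸ 1
<⇒≤∸1 (s≤s m≤n) = m≤n

+-overflow : ∀ {ρ β B} → ρ < B → β ≤ B → B ≤ ρ + β → ρ + β ∸ B < β × ρ + β ∸ B + (B ∸ β) ≡ ρ
+-overflow {ρ} {β} {B} ρ<B β≤B B≤ρ+β = T<β , T+[B∸β]≡ρ
  where
  T = ρ + β ∸ B
  T+B≡ : T + B ≡ ρ + β
  T+B≡ = m∸n+n≡m B≤ρ+β
  T<β : T < β
  T<β = +-cancelʳ-< B T β (subst₂ _<_ (sym T+B≡) (+-comm B β) (+-monoˡ-< β ρ<B))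
  T+[B∸β]≡ρ : T + (B ∸ β) ≡ ρ
  T+[B∸β]≡ρ = +-cancelʳ-≡ β _ ρ (trans (+-assoc T (B ∸ β) β) (trans (cong (T +_) (m∸n+n≡m β≤B)) T+B≡))

m%n≡o%n⇒m≡o+n*t : ∀ {m o} n .{{_ : NonZero n}} → m % n ≡ o % n → o ≤ m → ∃[ t ] m ≡ o + n * t
m%n≡o%n⇒m≡o+n*t {m} {o} n m≡o o≤m = t , (begin
  m                                  ≡⟨ m≡m%n+[m/n]*n m n ⟩
  m % n + m / n * n                  ≡⟨ cong₂ (λ ρ q → ρ + q * n) m≡o (sym (m+[n∸m]≡n (/-monoˡ-≤ n o≤m))) ⟩
  o % n + (o / n + t) * n            ≡⟨ cong (o % n +_) (*-distribʳ-+ n (o / n) t) ⟩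
  o % n + (o / n * n + t * n)        ≡⟨ +-assoc (o % n) _ _ ⟨
  o % n + o / n * n + t * n          ≡⟨ cong₂ _+_ (m≡m%n+[m/n]*n o n) (*-comm n t) ⟨
  o + n * t                          ∎)
  where
  open ≡-Reasoning
  t = m / n ∸ o / n

%-cong-* : ∀ {x y} n .{{_ : NonZero n}} z → x % n ≡ y % n → (x * z) % n ≡ (y * z) % n
%-cong-* {x} {y} n z x≡y = begin
  (x * z) % n                ≡⟨ %-distribˡ-* x z n ⟩
  ((x % n) * (z % n)) % n    ≡⟨ cong (λ ρ → (ρ * (z % n)) % n) x≡y ⟩
  ((y % n) * (z % n)) % n    ≡⟨ %-distribˡ-* y z n ⟨
  (y * z) % n                ∎
  where open ≡-Reasoning

∑< : ℕ → (ℕ → ℕ) → ℕ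
∑< n f = sum (applyUpTo f n)

∑<-suc : ∀ n f → ∑< (suc n) f ≡ ∑< n f + f n
∑<-suc n f = begin
  sum (applyUpTo f (suc n))        ≡⟨ cong sum (applyUpTo-∷ʳ f n) ⟨
  sum (applyUpTo f n ++ [ f n ])   ≡⟨ sum-++ (applyUpTo f n) [ f n ] ⟩
  ∑< n f + (f n + 0)               ≡⟨ cong (∑< n f +_) (+-identityʳ (f n)) ⟩
  ∑< n f + f n                     ∎
  where open ≡-Reasoning

∑<-cong : ∀ n {f g : ℕ → ℕ} → (∀ {i} → i < n → f i ≡ g i) → ∑< n f ≡ ∑< n g
∑<-cong zero    f≗g = refl
∑<-cong (suc n) f≗g = cong₂ _+_ (f≗g z<s) (∑<-cong n (f≗g ∘ s<s))

∑<-distrib-+ : ∀ n (f g : ℕ → ℕ) → ∑< n (λ i → f i + g i) ≡ ∑< n f + ∑< n g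
∑<-distrib-+ zero    f g = refl
∑<-distrib-+ (suc n) f g = trans (cong (f 0 + g 0 +_) (∑<-distrib-+ n (f ∘ suc) (g ∘ suc)))
                                 (interchange (f 0) (g 0) _ _)

∑<-const : ∀ n k → ∑< n (λ _ → k) ≡ n * k
∑<-const zero    k = refl
∑<-const (suc n) k = cong (k +_) (∑<-const n k)

∑<-reverse : ∀ n f → ∑< n f ≡ ∑< n (λ i → f (n ∸ suc i))
∑<-reverse zero    f = refl
∑<-reverse (suc n) f = begin
  ∑< (suc n) f                       ≡⟨ ∑<-suc n f ⟩
  ∑< n f + f n                       ≡⟨ cong (_+ f n) (∑<-reverse n f) ⟩
  ∑< n (λ i → f (n ∸ suc i)) + f n   ≡⟨ +-comm _ (f n) ⟩
  f n + ∑< n (λ i → f (n ∸ suc i))   ∎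
  where open ≡-Reasoning

extend : ∀ {n} → (Fin n → ℕ) → ℕ → ℕ
extend {zero}  x _       = 0
extend {suc n} x zero    = x fzero
extend {suc n} x (suc j) = extend (x ∘ fsuc) j

ΣFin≡∑<-extend : ∀ {n} (F : ℕ → ℕ → ℕ) (x : Fin n → ℕ) →
                 ΣFin (λ i → F (toℕ i) (x i)) ≡ ∑< n (λ j → F j (extend x j))
ΣFin≡∑<-extend {zero}  F x = refl
ΣFin≡∑<-extend {suc n} F x = cong (F 0 (x fzero) +_) (ΣFin≡∑<-extend (F ∘ suc) (x ∘ fsuc))

extend-∀ : ∀ {n} (x : Fin n → ℕ) (P : ℕ → ℕ → Set) → (∀ i → P (toℕ i) (x i)) →
           ∀ {j} → j < n → P j (extend x j)
extend-∀ {suc n} x P Px {zero}  _         = Px fzero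
extend-∀ {suc n} x P Px {suc j} (s<s j<n) = extend-∀ (x ∘ fsuc) (P ∘ suc) (Px ∘ fsuc) j<n

ΣFin-cong : ∀ {n} {f g : Fin n → ℕ} → (∀ i → f i ≡ g i) → ΣFin f ≡ ΣFin g
ΣFin-cong f≗g = cong sum (tabulate-cong f≗g)

ΣFin-linear : ∀ {n} c a (e g : Fin n → ℕ) →
              ΣFin (λ i → e i * (c * g i + a)) ≡ c * ΣFin (λ i → e i * g i) + a * ΣFin e
ΣFin-linear {zero}  c a e g = sym (cong₂ _+_ (*-zeroʳ c) (*-zeroʳ a))
ΣFin-linear {suc n} c a e g = trans (cong (e fzero * (c * g fzero + a) +_) (ΣFin-linear c a (e ∘ fsuc) (g ∘ fsuc)))
                                    (arith c a (e fzero) (g fzero) _ _)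
  where
  arith : ∀ c a e g s t → e * (c * g + a) + (c * s + a * t) ≡ c * (e * g + s) + a * (e + t)
  arith = solve-∀

∣⇒coprime-*+ : ∀ {a d z} q → Coprime a d → z ∣ a → Coprime z (q * a + d)
∣⇒coprime-*+ q a⊥d z∣a (i∣z , i∣q*a+d) =
  a⊥d (∣-trans i∣z z∣a , ∣m+n∣m⇒∣n i∣q*a+d (∣-trans (∣-trans i∣z z∣a) (n∣m*n q)))

*-inverse-mod : ∀ {n c} .{{_ : NonZero n}} → Coprime n c → ∃[ u ] (c * u) % n ≡ 1 % n
*-inverse-mod {suc n-1} {c} n⊥c with coprime-Bézout (Coprimality.sym n⊥c)
... | Bézout.+- x y 1+yn≡xc = x , (begin
  (c * x) % n      ≡⟨ cong (_% n) (*-comm c x) ⟩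
  (x * c) % n      ≡⟨ cong (_% n) 1+yn≡xc ⟨
  (1 + y * n) % n  ≡⟨ [m+kn]%n≡m%n 1 y n ⟩
  1 % n            ∎)
  where
  open ≡-Reasoning
  n = suc n-1
... | Bézout.-+ x y 1+xc≡yn = x * n-1 , (begin
  (c * (x * n-1)) % n               ≡⟨ [m+n]%n≡m%n (c * (x * n-1)) n ⟨
  (c * (x * n-1) + n) % n           ≡⟨ cong (_% n) (trans (lhs c x n-1) (cong (λ z → z * n-1 + 1) 1+xc≡yn)) ⟩
  (y * n * n-1 + 1) % n             ≡⟨ cong (_% n) (rhs y n-1) ⟩
  (1 + y * n-1 * n) % n             ≡⟨ [m+kn]%n≡m%n 1 (y * n-1) n ⟩
  1 % n                             ∎)
  where
  open ≡-Reasoning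
  n = suc n-1
  -- c x ≡ -1 (mod n), so c x (n - 1) ≡ 1 (mod n).
  lhs : ∀ c x n-1 → c * (x * n-1) + suc n-1 ≡ (1 + x * c) * n-1 + 1
  lhs = solve-∀
  rhs : ∀ y n-1 → y * suc n-1 * n-1 + 1 ≡ 1 + y * n-1 * suc n-1
  rhs = solve-∀

*-injective-mod : ∀ {n c} .{{_ : NonZero n}} → Coprime n c →
              ∀ {r r′} → r < n → r′ < n → (c * r) % n ≡ (c * r′) % n → r ≡ r′
*-injective-mod {n} {c} n⊥c {r} {r′} r<n r′<n cr≡cr′ = begin
  r                 ≡⟨ cancel r<n ⟨
  (c * u * r) % n   ≡⟨ cong (_% n) (swap c u r) ⟩
  (c * r * u) % n   ≡⟨ %-cong-* n u cr≡cr′ ⟩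
  (c * r′ * u) % n  ≡⟨ cong (_% n) (swap c r′ u) ⟩
  (c * u * r′) % n  ≡⟨ cancel r′<n ⟩
  r′                ∎
  where
  open ≡-Reasoning
  u = proj₁ (*-inverse-mod n⊥c)
  swap : ∀ x y z → x * y * z ≡ x * z * y
  swap = solve-∀
  cancel : ∀ {s} → s < n → (c * u * s) % n ≡ s
  cancel {s} s<n = trans (%-cong-* n s (proj₂ (*-inverse-mod n⊥c)))
                         (trans (cong (_% n) (*-identityˡ s)) (m<n⇒m%n≡m s<n))

*-surjective-mod : ∀ {n c} .{{_ : NonZero n}} → Coprime n c → ∀ x → ∃[ r ] r < n × (c * r) % n ≡ x % n
*-surjective-mod {n} {c} n⊥c x = r , m%n<n (x * u) n , (begin
  (c * r) % n      ≡⟨ cong (_% n) (*-comm c r) ⟩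
  (r * c) % n      ≡⟨ %-cong-* n c (m%n%n≡m%n (x * u) n) ⟩
  (x * u * c) % n  ≡⟨ cong (_% n) (shuffle x u c) ⟩
  (c * u * x) % n  ≡⟨ %-cong-* n x (proj₂ (*-inverse-mod n⊥c)) ⟩
  (1 * x) % n      ≡⟨ cong (_% n) (*-identityˡ x) ⟩
  x % n            ∎)
  where
  open ≡-Reasoning
  u = proj₁ (*-inverse-mod n⊥c)
  r = (x * u) % n
  shuffle : ∀ x u c → x * u * c ≡ c * u * x
  shuffle = solve-∀

⌊cr/n⌋+⌊c[n∸r]/n⌋≡c∸1 : ∀ {n c} .{{_ : NonZero n}} → Coprime n c →
             ∀ {r} → 0 < r → r < n → c * r / n + c * (n ∸ r) / n ≡ c ∸ 1
⌊cr/n⌋+⌊c[n∸r]/n⌋≡c∸1 {n} {c} n⊥c {r} 0<r r<n = sym (cong (_∸ 1) (≤-antisym c≤1+s 1+s≤c))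
  where
  r′ = n ∸ r
  s = c * r / n + c * r′ / n
  ρ = (c * r) % n
  ρ′ = (c * r′) % n
  residues+s*n≡c*n : ρ + ρ′ + s * n ≡ c * n
  residues+s*n≡c*n = sym (begin
    c * n                                          ≡⟨ cong (c *_) (m+[n∸m]≡n (<⇒≤ r<n)) ⟨
    c * (r + r′)                                   ≡⟨ *-distribˡ-+ c r r′ ⟩
    c * r + c * r′                                 ≡⟨ cong₂ _+_ (m≡m%n+[m/n]*n (c * r) n) (m≡m%n+[m/n]*n (c * r′) n) ⟩
    ρ + c * r / n * n + (ρ′ + c * r′ / n * n)     ≡⟨ shuffle ρ (c * r / n) ρ′ (c * r′ / n) n ⟩
    ρ + ρ′ + s * n                                 ∎)
    where
    open ≡-Reasoning
    shuffle : ∀ ρ q ρ′ q′ n → ρ + q * n + (ρ′ + q′ * n) ≡ ρ + ρ′ + (q + q′) * n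
    shuffle = solve-∀
  0<ρ : 0 < ρ
  0<ρ = n≢0⇒n>0 λ ρ≡0 → <⇒≢ 0<r (sym (*-injective-mod n⊥c r<n 0<n (trans ρ≡0 (sym c*0%n≡0))))
    where
    0<n : 0 < n
    0<n = >-nonZero⁻¹ n
    c*0%n≡0 : (c * 0) % n ≡ 0
    c*0%n≡0 = trans (cong (_% n) (*-zeroʳ c)) (m<n⇒m%n≡m 0<n)
  1+s≤c : suc s ≤ c
  1+s≤c = *-cancelʳ-< n s c (begin-strict
    s * n            <⟨ m<n+m (s * n) (<-≤-trans 0<ρ (m≤m+n ρ ρ′)) ⟩
    ρ + ρ′ + s * n   ≡⟨ residues+s*n≡c*n ⟩
    c * n            ∎)
    where open ≤-Reasoning
  c≤1+s : c ≤ suc s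
  c≤1+s = ≤-pred (*-cancelʳ-< n c (suc (suc s)) (begin-strict
    c * n            ≡⟨ residues+s*n≡c*n ⟨
    ρ + ρ′ + s * n   <⟨ +-monoˡ-< (s * n) (+-mono-< (m%n<n (c * r) n) (m%n<n (c * r′) n)) ⟩
    n + n + s * n    ≡⟨ +-assoc n n (s * n) ⟩
    suc (suc s) * n  ∎))
    where open ≤-Reasoning

2*∑⌊cr/n⌋≡[c∸1]*[n∸1] : ∀ {n c} .{{_ : NonZero n}} → Coprime n c →
          2 * Σ1to (n ∸ 1) (λ r → c * r / n) ≡ (c ∸ 1) * (n ∸ 1)
2*∑⌊cr/n⌋≡[c∸1]*[n∸1] {suc n-1} {c} n⊥c = begin
  2 * S                                       ≡⟨ cong (S +_) (+-identityʳ S) ⟩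
  S + S                                       ≡⟨ cong (S +_) (∑<-reverse n-1 f) ⟩
  S + ∑< n-1 (λ i → f (n-1 ∸ suc i))          ≡⟨ ∑<-distrib-+ n-1 f _ ⟨
  ∑< n-1 (λ i → f i + f (n-1 ∸ suc i))        ≡⟨ ∑<-cong n-1 pair ⟩
  ∑< n-1 (λ _ → c ∸ 1)                        ≡⟨ ∑<-const n-1 (c ∸ 1) ⟩
  n-1 * (c ∸ 1)                               ≡⟨ *-comm n-1 (c ∸ 1) ⟩
  (c ∸ 1) * n-1                               ∎
  where
  open ≡-Reasoning
  n = suc n-1
  f : ℕ → ℕ
  f i = c * suc i / n
  S = ∑< n-1 f
  pair : ∀ {i} → i < n-1 → f i + f (n-1 ∸ suc i) ≡ c ∸ 1
  pair {i} i<n-1 = trans (cong (λ j → f i + c * j / n) (sym (+-∸-assoc 1 i<n-1))) (⌊cr/n⌋+⌊c[n∸r]/n⌋≡c∸1 n⊥c z<s (s<s i<n-1))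

-- {w r | r < n} is the Apéry set of S with respect to n, with w r the least element of S
-- in the residue class of w r; the gaps in that class are w r % n + i n for i < w r / n.
module Apéry {n : ℕ} .{{_ : NonZero n}} (S : ℕ → Set) (w : ℕ → ℕ) (w0≡0 : w 0 ≡ 0)
  (w-injective : ∀ {r r′} → r < n → r′ < n → w r % n ≡ w r′ % n → r ≡ r′)
  (w-surjective : ∀ x → ∃[ r ] r < n × w r % n ≡ x % n)
  (S⇔ : ∀ x → S x ⇔ (∃[ r ] r < n × ∃[ t ] x ≡ w r + n * t)) where

  block : ℕ → List ℕ
  block r = applyUpTo (λ i → w r % n + i * n) (w r / n)

  ∈-block⁻ : ∀ {r x} → x ∈ block r → x % n ≡ w r % n × x < w r
  ∈-block⁻ {r} x∈ with ∈-applyUpTo⁻ (λ i → w r % n + i * n) x∈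
  ... | i , i<q , refl = [m+kn]%n≡m i (m%n<n (w r) n) , (begin-strict
    w r % n + i * n          <⟨ +-monoʳ-< (w r % n) (*-monoˡ-< n i<q) ⟩
    w r % n + w r / n * n    ≡⟨ m≡m%n+[m/n]*n (w r) n ⟨
    w r                      ∎)
    where open ≤-Reasoning

  ∈-block⁺ : ∀ {r x} → x % n ≡ w r % n → x < w r → x ∈ block r
  ∈-block⁺ {r} {x} x≡w x<w = subst (_∈ block r) (sym x≡) (∈-applyUpTo⁺ (λ i → w r % n + i * n) q<)
    where
    x≡ : x ≡ w r % n + x / n * n
    x≡ = trans (m≡m%n+[m/n]*n x n) (cong (_+ x / n * n) x≡w)
    q< : x / n < w r / n
    q< = *-cancelʳ-< n (x / n) (w r / n) (+-cancelˡ-< (w r % n) _ _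
           (subst₂ _<_ x≡ (m≡m%n+[m/n]*n (w r) n) x<w))

  block-unique : ∀ r → Unique (block r)
  block-unique r = UniqueP.applyUpTo⁺₁ _ (w r / n)
    (λ {i} {j} i<j _ eq → <⇒≢ i<j (*-cancelʳ-≡ i j n (+-cancelˡ-≡ (w r % n) _ _ eq)))

  gaps : ℕ → List ℕ
  gaps zero    = []
  gaps (suc m) = gaps m ++ block (suc m)

  ∈-gaps⁻ : ∀ m {x} → x ∈ gaps m → ∃[ r ] 0 < r × r ≤ m × x ∈ block r
  ∈-gaps⁻ (suc m) x∈ with ∈-++⁻ (gaps m) x∈
  ... | inj₂ x∈b = suc m , z<s , ≤-refl , x∈b
  ... | inj₁ x∈g with ∈-gaps⁻ m x∈g
  ...   | r , 0<r , r≤m , x∈b = r , 0<r , m≤n⇒m≤1+n r≤m , x∈b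

  ∈-gaps⁺ : ∀ m {r x} → 0 < r → r ≤ m → x ∈ block r → x ∈ gaps m
  ∈-gaps⁺ zero    {suc _} _ () _
  ∈-gaps⁺ (suc m) {r} 0<r r≤1+m x∈ with m≤n⇒m<n∨m≡n r≤1+m
  ... | inj₂ refl   = ∈-++⁺ʳ (gaps m) x∈
  ... | inj₁ r<1+m = ∈-++⁺ˡ (∈-gaps⁺ m 0<r (≤-pred r<1+m) x∈)

  gaps-unique : ∀ m → m < n → Unique (gaps m)
  gaps-unique zero    _     = AllPairs.[]
  gaps-unique (suc m) 1+m<n = UniqueP.++⁺ (gaps-unique m (<-trans (n<1+n m) 1+m<n)) (block-unique (suc m)) disjoint
    where
    disjoint : ∀ {x} → ¬ (x ∈ gaps m × x ∈ block (suc m))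
    disjoint (x∈g , x∈b) with ∈-gaps⁻ m x∈g
    ... | r , _ , r≤m , x∈b′ = <⇒≢ (s≤s r≤m) (w-injective (≤-<-trans r≤m (<-trans (n<1+n m) 1+m<n)) 1+m<n
            (trans (sym (proj₁ (∈-block⁻ x∈b′))) (proj₁ (∈-block⁻ x∈b))))

  length-gaps : ∀ m → length (gaps m) ≡ Σ1to m (λ r → w r / n)
  length-gaps zero    = refl
  length-gaps (suc m) = begin
    length (gaps m ++ block (suc m))               ≡⟨ length-++ (gaps m) ⟩
    length (gaps m) + length (block (suc m))       ≡⟨ cong₂ _+_ (length-gaps m) (length-applyUpTo _ (w (suc m) / n)) ⟩
    Σ1to m (λ r → w r / n) + w (suc m) / n         ≡⟨ ∑<-suc m (λ r → w (suc r) / n) ⟨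
    Σ1to (suc m) (λ r → w r / n)                   ∎
    where open ≡-Reasoning

  S-from-w≤ : ∀ {r x} → r < n → x % n ≡ w r % n → w r ≤ x → S x
  S-from-w≤ {r} {x} r<n x≡w w≤x with m%n≡o%n⇒m≡o+n*t n x≡w w≤x
  ... | t , x≡ = Equivalence.from (S⇔ x) (r , r<n , t , x≡)

  w≤-from-S : ∀ {r x} → r < n → x % n ≡ w r % n → S x → w r ≤ x
  w≤-from-S {r} {x} r<n x≡w Sx with Equivalence.to (S⇔ x) Sx
  ... | r′ , r′<n , t , refl = subst (λ s → w s ≤ x) r′≡r (m≤m+n (w r′) (n * t))
    where
    r′≡r : r′ ≡ r
    r′≡r = w-injective r′<n r<n (trans (sym ([m+kn]%n≡m%n (w r′) t n)) (trans (cong (λ z → (w r′ + z) % n) (*-comm t n)) x≡w))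

  gap⇔ : ∀ x → x ∈ gaps (n ∸ 1) ⇔ (0 < x × ¬ S x)
  gap⇔ x = mk⇔ to from
    where
    to : x ∈ gaps (n ∸ 1) → 0 < x × ¬ S x
    to x∈ with ∈-gaps⁻ (n ∸ 1) x∈
    ... | r , 0<r , r≤n∸1 , x∈b = n≢0⇒n>0 x≢0 , λ Sx → <⇒≱ x<w (w≤-from-S r<n x≡w Sx)
      where
      r<n : r < n
      r<n = ≤∸1⇒< r≤n∸1
      x≡w : x % n ≡ w r % n
      x≡w = proj₁ (∈-block⁻ x∈b)
      x<w : x < w r
      x<w = proj₂ (∈-block⁻ x∈b)
      x≢0 : x ≢ 0
      x≢0 refl = <⇒≢ 0<r (w-injective (>-nonZero⁻¹ n) r<n (trans (cong (_% n) w0≡0) x≡w))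
    from : 0 < x × ¬ S x → x ∈ gaps (n ∸ 1)
    from (_ , ¬Sx) with w-surjective x
    ... | r , r<n , w≡x with w r ≤? x
    ...   | yes w≤x = ⊥-elim (¬Sx (S-from-w≤ r<n (sym w≡x) w≤x))
    ...   | no  w≰x = ∈-gaps⁺ (n ∸ 1) 0<r (<⇒≤∸1 r<n) (∈-block⁺ (sym w≡x) (≰⇒> w≰x))
      where
      0<r : 0 < r
      0<r = n≢0⇒n>0 λ { refl → w≰x (subst (_≤ x) (sym w0≡0) z≤n) }

  hasGenus : HasGenus S (Σ1to (n ∸ 1) (λ r → w r / n))
  hasGenus = gaps (n ∸ 1) , gaps-unique (n ∸ 1) (≤∸1⇒< ≤-refl) , gap⇔ , length-gaps (n ∸ 1)

module DigitSum (b-1 : ℕ) where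

  b : ℕ
  b = suc b-1

  b[_] : ℕ → ℕ
  b[ i ] = B b i

  b[]≤b[1+] : ∀ i → b[ i ] ≤ b[ suc i ]
  b[]≤b[1+] i = m≤n⇒m≤1+n (m≤m+n b[ i ] (b-1 * b[ i ]))

  b[]-mono-≤ : ∀ {i j} → i ≤ j → b[ i ] ≤ b[ j ]
  b[]-mono-≤ = mono ∘ ≤⇒≤′
    where
    mono : ∀ {i j} → i ≤′ j → b[ i ] ≤ b[ j ]
    mono ≤′-refl          = ≤-refl
    mono (≤′-step i≤′j) = ≤-trans (mono i≤′j) (b[]≤b[1+] _)

  b^≡b-1*b[]+1 : ∀ i → b ^ i ≡ b-1 * b[ i ] + 1
  b^≡b-1*b[]+1 zero    = sym (cong (_+ 1) (*-zeroʳ b-1))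
  b^≡b-1*b[]+1 (suc i) = trans (cong (b *_) (b^≡b-1*b[]+1 i)) (arith b-1 b[ i ])
    where
    arith : ∀ x y → (1 + x) * (x * y + 1) ≡ x * (1 + (1 + x) * y) + 1
    arith = solve-∀

  -- The top digit b_m is unbounded, so digitSum m N is (x_1 + ⋯ + x_m) for the greedy
  -- presentation X(N) w.r.t. (b_1, …, b_m); digitSum 0 N = 0 is junk.
  digitSum : ℕ → ℕ → ℕ
  digitSum zero    N = 0
  digitSum (suc m) N = N / b[ suc m ] + digitSum m (N % b[ suc m ])

  digitSum-zero : ∀ m → digitSum m 0 ≡ 0
  digitSum-zero zero    = refl
  digitSum-zero (suc m) = digitSum-zero m

  digitSum-top : ∀ m {V} y → V < b[ suc m ] → digitSum (suc m) (V + y * b[ suc m ]) ≡ y + digitSum m V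
  digitSum-top m y V< = cong₂ _+_ ([m+kn]/n≡k y V<) (cong (digitSum m) ([m+kn]%n≡m y V<))

  digitSum-*b[] : ∀ m y → digitSum (suc m) (y * b[ suc m ]) ≡ y
  digitSum-*b[] m y = trans (digitSum-top m y z<s) (trans (cong (y +_) (digitSum-zero m)) (+-identityʳ y))

  digitSum-below : ∀ m {V} → V < b[ suc m ] → digitSum (suc m) V ≡ digitSum m V
  digitSum-below m {V} V< = trans (cong (digitSum (suc m)) (sym (+-identityʳ V))) (digitSum-top m 0 V<)

  digitSum-lower : ∀ {l m V} → l ≤ m → V < b[ suc l ] → digitSum m V ≡ digitSum l V
  digitSum-lower {l} {V = V} l≤m V< = go (≤⇒≤′ l≤m)
    where
    go : ∀ {m} → l ≤′ m → digitSum m V ≡ digitSum l V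
    go ≤′-refl                = refl
    go (≤′-step {m} l≤′m) =
      trans (digitSum-below m (<-≤-trans V< (b[]-mono-≤ (s≤s (≤′⇒≤ l≤′m))))) (go l≤′m)

  digitSum-b*b[] : ∀ {i j} → i ≤ j → digitSum j (b * b[ i ]) ≤ b
  digitSum-b*b[] {i} i≤j = ≤-trans (≤-reflexive (digitSum-lower i≤j ≤-refl)) (top i)
    where
    top : ∀ i → digitSum i (b * b[ i ]) ≤ b
    top zero    = z≤n
    top (suc i) = ≤-reflexive (digitSum-*b[] i b)

  digitSum-bound : ∀ m {R} → R < b[ suc m ] → digitSum m R ≤ m * b-1 + 1
  digitSum-bound zero    _ = z≤n
  digitSum-bound (suc m) {R} R< with m≤n⇒m<n∨m≡n (≤-pred R<)
  ... | inj₁ R<b*B = ≤-trans (+-mono-≤ (≤-pred (m<n*o⇒m/o<n {n = b} {o = b[ suc m ]} R<b*B)) (digitSum-bound m (m%n<n R _)))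
                             (≤-reflexive (sym (+-assoc b-1 _ 1)))
  ... | inj₂ refl  = ≤-trans (digitSum-b*b[] {suc m} ≤-refl)
                             (≤-trans (≤-reflexive (+-comm 1 b-1)) (+-monoˡ-≤ 1 (m≤m+n b-1 (m * b-1))))

  digitSum-suc : ∀ m U → digitSum m U ≤ digitSum m (suc U) + b-1
  digitSum-suc zero    U = z≤n
  digitSum-suc (suc m) U with m≤n⇒m<n∨m≡n (m%n<n U b[ suc m ])
  ... | inj₁ 1+ρ<B = begin
    q + digitSum m ρ                                 ≤⟨ +-monoʳ-≤ q (digitSum-suc m ρ) ⟩
    q + (digitSum m (suc ρ) + b-1)                   ≡⟨ +-assoc q _ b-1 ⟨
    q + digitSum m (suc ρ) + b-1                     ≡⟨ cong (_+ b-1) (digitSum-top m q 1+ρ<B) ⟨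
    digitSum (suc m) (suc ρ + q * b[ suc m ]) + b-1  ≡⟨ cong (λ N → digitSum (suc m) (suc N) + b-1) U≡ ⟨
    digitSum (suc m) (suc U) + b-1                   ∎
    where
    open ≤-Reasoning
    q = U / b[ suc m ]
    ρ = U % b[ suc m ]
    U≡ : U ≡ ρ + q * b[ suc m ]
    U≡ = m≡m%n+[m/n]*n U b[ suc m ]
  ... | inj₂ 1+ρ≡B = begin
    q + digitSum m ρ                          ≡⟨ cong (λ N → q + digitSum m N) (suc-injective 1+ρ≡B) ⟩
    q + digitSum m (b * b[ m ])               ≤⟨ +-monoʳ-≤ q (digitSum-b*b[] {m} ≤-refl) ⟩
    q + b                                     ≡⟨ +-suc q b-1 ⟩
    suc q + b-1                               ≡⟨ cong (_+ b-1) (digitSum-*b[] m (suc q)) ⟨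
    digitSum (suc m) (suc q * b[ suc m ]) + b-1  ≡⟨ cong (λ N → digitSum (suc m) N + b-1) 1+U≡ ⟨
    digitSum (suc m) (suc U) + b-1            ∎
    where
    open ≤-Reasoning
    q = U / b[ suc m ]
    ρ = U % b[ suc m ]
    1+U≡ : suc U ≡ suc q * b[ suc m ]
    1+U≡ = trans (cong suc (m≡m%n+[m/n]*n U b[ suc m ])) (cong (_+ q * b[ suc m ]) 1+ρ≡B)

  +b[2+m]∸b[i]≡ : ∀ m {i} T → i ≤ suc m →
                  T + (b[ suc (suc m) ] ∸ b[ i ]) ≡ suc (T + (b[ suc m ] ∸ b[ i ])) + b-1 * b[ suc m ]
  +b[2+m]∸b[i]≡ m {i} T i≤1+m = begin
    T + (b[ suc (suc m) ] ∸ b[ i ])                      ≡⟨ cong (λ x → T + (suc x ∸ b[ i ])) (+-comm b[ suc m ] _) ⟩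
    T + ((suc (b-1 * b[ suc m ]) + b[ suc m ]) ∸ b[ i ])  ≡⟨ cong (T +_) (+-∸-assoc (suc (b-1 * b[ suc m ])) (b[]-mono-≤ i≤1+m)) ⟩
    T + (suc (b-1 * b[ suc m ]) + (b[ suc m ] ∸ b[ i ]))  ≡⟨ shuffle T (b-1 * b[ suc m ]) _ ⟩
    suc (T + (b[ suc m ] ∸ b[ i ])) + b-1 * b[ suc m ]   ∎
    where
    open ≡-Reasoning
    shuffle : ∀ T x e → T + (suc x + e) ≡ suc (T + e) + x
    shuffle = solve-∀

  -- One level down, T + (b_{m+2} - b_i) has top digit b - 1 and remainder 1 + T + (b_{m+1} - b_i):
  -- either that stays below b_{m+1} (induction, with digitSum-suc paying for the extra 1), or
  -- it equals b_{m+1}, forcing T = b b_{i-1} with digit sum at most b.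
  digitSum-+gap : ∀ m {i T} → i ≤ suc m → T < b[ i ] →
                  digitSum m T ≤ digitSum m (T + (b[ suc m ] ∸ b[ i ]))
  digitSum-+gap zero    _ _ = z≤n
  digitSum-+gap (suc m) {i} {T} i≤2+m T<bi with m≤n⇒m<n∨m≡n i≤2+m
  ... | inj₂ refl = ≤-reflexive (cong (digitSum (suc m)) (sym (trans (cong (T +_) (n∸n≡0 b[ i ])) (+-identityʳ T))))
  ... | inj₁ i<2+m = go (suc (T + E) <? b[ suc m ])
    where
    i≤1+m : i ≤ suc m
    i≤1+m = ≤-pred i<2+m
    E = b[ suc m ] ∸ b[ i ]
    bi+E≡ : b[ i ] + E ≡ b[ suc m ]
    bi+E≡ = m+[n∸m]≡n (b[]-mono-≤ i≤1+m)
    T+gap≡ : T + (b[ suc (suc m) ] ∸ b[ i ]) ≡ suc (T + E) + b-1 * b[ suc m ]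
    T+gap≡ = +b[2+m]∸b[i]≡ m T i≤1+m
    go : Dec (suc (T + E) < b[ suc m ]) →
         digitSum (suc m) T ≤ digitSum (suc m) (T + (b[ suc (suc m) ] ∸ b[ i ]))
    go (yes 1+T+E<B) = begin
      digitSum (suc m) T                                  ≡⟨ digitSum-below m (<-≤-trans T<bi (b[]-mono-≤ i≤1+m)) ⟩
      digitSum m T                                        ≤⟨ digitSum-suc m T ⟩
      digitSum m (suc T) + b-1                            ≤⟨ +-monoˡ-≤ b-1 (digitSum-+gap m i≤1+m 1+T<bi) ⟩
      digitSum m (suc (T + E)) + b-1                      ≡⟨ +-comm _ b-1 ⟩
      b-1 + digitSum m (suc (T + E))                      ≡⟨ digitSum-top m b-1 1+T+E<B ⟨
      digitSum (suc m) (suc (T + E) + b-1 * b[ suc m ])   ≡⟨ cong (digitSum (suc m)) T+gap≡ ⟨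
      digitSum (suc m) (T + (b[ suc (suc m) ] ∸ b[ i ]))  ∎
      where
      open ≤-Reasoning
      1+T<bi : suc T < b[ i ]
      1+T<bi = +-cancelʳ-< E (suc T) b[ i ] (subst (suc (T + E) <_) (sym bi+E≡) 1+T+E<B)
    go (no 1+T+E≮B) = begin
      digitSum (suc m) T                                  ≤⟨ bound-T i≤1+m 1+T≡bi ⟩
      b                                                   ≡⟨ digitSum-*b[] m b ⟨
      digitSum (suc m) (b * b[ suc m ])                   ≡⟨ cong (λ x → digitSum (suc m) (x + b-1 * b[ suc m ])) 1+T+E≡B ⟨
      digitSum (suc m) (suc (T + E) + b-1 * b[ suc m ])   ≡⟨ cong (digitSum (suc m)) T+gap≡ ⟨
      digitSum (suc m) (T + (b[ suc (suc m) ] ∸ b[ i ]))  ∎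
      where
      open ≤-Reasoning
      1+T+E≡B : suc (T + E) ≡ b[ suc m ]
      1+T+E≡B = ≤-antisym (subst (suc (T + E) ≤_) bi+E≡ (+-monoˡ-≤ E T<bi)) (≮⇒≥ 1+T+E≮B)
      1+T≡bi : suc T ≡ b[ i ]
      1+T≡bi = +-cancelʳ-≡ E (suc T) b[ i ] (trans 1+T+E≡B (sym bi+E≡))
      bound-T : ∀ {j} → j ≤ suc m → suc T ≡ b[ j ] → digitSum (suc m) T ≤ b
      bound-T {suc j} j≤1+m 1+T≡ with suc-injective 1+T≡
      ... | refl = digitSum-b*b[] (≤-trans (n≤1+n j) j≤1+m)

  -- Adding b_i raises the greedy digit sum by at most one: if the remainder ρ overflows,
  -- ρ + b_i = T + b_{m+1} with ρ = T + (b_{m+1} - b_i), and digitSum-+gap applies.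
  digitSum-+b[] : ∀ j {i} N → i ≤ j → digitSum j (N + b[ i ]) ≤ suc (digitSum j N)
  digitSum-+b[] zero    N _ = z≤n
  digitSum-+b[] (suc m) {i} N i≤1+m with m≤n⇒m<n∨m≡n i≤1+m
  ... | inj₂ refl = ≤-reflexive (trans (cong (digitSum (suc m)) N+B≡) (digitSum-top m (suc q) (m%n<n N Bm)))
    where
    Bm = b[ suc m ]
    q = N / Bm
    N+B≡ : N + Bm ≡ N % Bm + suc q * Bm
    N+B≡ = trans (cong (_+ Bm) (m≡m%n+[m/n]*n N Bm)) (shuffle (N % Bm) (q * Bm) Bm)
      where
      shuffle : ∀ r x y → r + x + y ≡ r + (y + x)
      shuffle = solve-∀
  ... | inj₁ i<1+m = go (ρ + b[ i ] <? Bm)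
    where
    Bm = b[ suc m ]
    q = N / Bm
    ρ = N % Bm
    shuffle : ∀ r x y → r + x + y ≡ r + y + x
    shuffle = solve-∀
    N+bi≡ : N + b[ i ] ≡ ρ + b[ i ] + q * Bm
    N+bi≡ = trans (cong (_+ b[ i ]) (m≡m%n+[m/n]*n N Bm)) (shuffle ρ (q * Bm) b[ i ])
    go : Dec (ρ + b[ i ] < Bm) → digitSum (suc m) (N + b[ i ]) ≤ suc (digitSum (suc m) N)
    go (yes ρ+bi<B) = begin
      digitSum (suc m) (N + b[ i ])                ≡⟨ cong (digitSum (suc m)) N+bi≡ ⟩
      digitSum (suc m) (ρ + b[ i ] + q * Bm)       ≡⟨ digitSum-top m q ρ+bi<B ⟩
      q + digitSum m (ρ + b[ i ])                  ≤⟨ +-monoʳ-≤ q (digitSum-+b[] m ρ (≤-pred i<1+m)) ⟩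
      q + suc (digitSum m ρ)                       ≡⟨ +-suc q _ ⟩
      suc (digitSum (suc m) N)                     ∎
      where open ≤-Reasoning
    go (no ρ+bi≮B) = begin
      digitSum (suc m) (N + b[ i ])                ≡⟨ cong (digitSum (suc m)) (trans N+bi≡ ρ+bi+qB≡) ⟩
      digitSum (suc m) (T + suc q * Bm)            ≡⟨ digitSum-top m (suc q) (<-≤-trans T<bi bi≤B) ⟩
      suc q + digitSum m T                         ≤⟨ +-monoʳ-≤ (suc q) (digitSum-+gap m (<⇒≤ i<1+m) T<bi) ⟩
      suc q + digitSum m (T + (Bm ∸ b[ i ]))       ≡⟨ cong (λ x → suc q + digitSum m x) T+E≡ρ ⟩
      suc (digitSum (suc m) N)                     ∎
      where
      open ≤-Reasoning
      bi≤B : b[ i ] ≤ Bm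
      bi≤B = b[]-mono-≤ (<⇒≤ i<1+m)
      T = ρ + b[ i ] ∸ Bm
      T<bi : T < b[ i ]
      T<bi = proj₁ (+-overflow (m%n<n N Bm) bi≤B (≮⇒≥ ρ+bi≮B))
      T+E≡ρ : T + (Bm ∸ b[ i ]) ≡ ρ
      T+E≡ρ = proj₂ (+-overflow (m%n<n N Bm) bi≤B (≮⇒≥ ρ+bi≮B))
      ρ+bi+qB≡ : ρ + b[ i ] + q * Bm ≡ T + suc q * Bm
      ρ+bi+qB≡ = trans (cong (_+ q * Bm) (sym (m∸n+n≡m (≮⇒≥ ρ+bi≮B)))) (+-assoc T Bm (q * Bm))

  digitSum-+*b[] : ∀ j {i} N e → i ≤ j → digitSum j (N + e * b[ i ]) ≤ digitSum j N + e
  digitSum-+*b[] j N zero    _ = ≤-reflexive (trans (cong (digitSum j) (+-identityʳ N)) (sym (+-identityʳ _)))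
  digitSum-+*b[] j {i} N (suc e) i≤j = begin
    digitSum j (N + (b[ i ] + e * b[ i ]))  ≡⟨ cong (digitSum j) (shuffle N (e * b[ i ]) b[ i ]) ⟩
    digitSum j (N + e * b[ i ] + b[ i ])    ≤⟨ digitSum-+b[] j _ i≤j ⟩
    suc (digitSum j (N + e * b[ i ]))       ≤⟨ s≤s (digitSum-+*b[] j N e i≤j) ⟩
    suc (digitSum j N + e)                  ≡⟨ +-suc _ e ⟨
    digitSum j N + suc e                    ∎
    where
    open ≤-Reasoning
    shuffle : ∀ n x y → n + (y + x) ≡ n + x + y
    shuffle = solve-∀

  digitSum-minimal : ∀ j {n} (e idx : Fin n → ℕ) → (∀ i → idx i ≤ j) →
                     digitSum j (ΣFin (λ i → e i * b[ idx i ])) ≤ ΣFin e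
  digitSum-minimal j {zero}  e idx _     = ≤-reflexive (digitSum-zero j)
  digitSum-minimal j {suc n} e idx idx≤j = begin
    digitSum j (e₀ * b[ idx fzero ] + R)  ≡⟨ cong (digitSum j) (+-comm _ R) ⟩
    digitSum j (R + e₀ * b[ idx fzero ])  ≤⟨ digitSum-+*b[] j R e₀ (idx≤j fzero) ⟩
    digitSum j R + e₀                      ≤⟨ +-monoˡ-≤ e₀ (digitSum-minimal j (e ∘ fsuc) (idx ∘ fsuc) (idx≤j ∘ fsuc)) ⟩
    ΣFin (e ∘ fsuc) + e₀                   ≡⟨ +-comm _ e₀ ⟩
    ΣFin e                                 ∎
    where
    open ≤-Reasoning
    e₀ = e fzero
    R = ΣFin (λ i → e (fsuc i) * b[ idx (fsuc i) ])

  digitSum-+ : ∀ m N a → digitSum (suc m) N ≤ digitSum (suc m) (N + a) + (m * b-1 + 1)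
  digitSum-+ m N a = ≤-trans
    (+-mono-≤ (/-monoˡ-≤ b[ suc m ] (m≤m+n N a)) (digitSum-bound m (m%n<n N b[ suc m ])))
    (+-monoˡ-≤ (m * b-1 + 1) (m≤m+n ((N + a) / b[ suc m ]) (digitSum m ((N + a) % b[ suc m ]))))

  digitSum-+* : ∀ m N a t → digitSum (suc m) N ≤ digitSum (suc m) (N + t * a) + t * (m * b-1 + 1)
  digitSum-+* m N a zero    = ≤-reflexive (sym (trans (+-identityʳ _) (cong (digitSum (suc m)) (+-identityʳ N))))
  digitSum-+* m N a (suc t) = begin
    digitSum (suc m) N                                ≤⟨ digitSum-+* m N a t ⟩
    digitSum (suc m) (N + t * a) + t * K              ≤⟨ +-monoˡ-≤ (t * K) (digitSum-+ m (N + t * a) a) ⟩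
    digitSum (suc m) (N + t * a + a) + K + t * K      ≡⟨ +-assoc (digitSum (suc m) (N + t * a + a)) K (t * K) ⟩
    digitSum (suc m) (N + t * a + a) + (K + t * K)    ≡⟨ cong (λ x → digitSum (suc m) x + (K + t * K)) (shuffle N (t * a) a) ⟩
    digitSum (suc m) (N + (a + t * a)) + (K + t * K)  ∎
    where
    open ≤-Reasoning
    K = m * b-1 + 1
    shuffle : ∀ n x y → n + x + y ≡ n + (y + x)
    shuffle = solve-∀

  digitValue : (ℕ → ℕ) → ℕ → ℕ
  digitValue y j = ∑< j (λ l → b[ suc l ] * y l)

  digitSum-digitValue : ∀ (y : ℕ → ℕ) j → (∀ {i} → i < j → digitValue y i < b[ suc i ]) →
                        ∑< j y ≡ digitSum j (digitValue y j)
  digitSum-digitValue y zero    _       = refl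
  digitSum-digitValue y (suc j) prefix< = begin
    ∑< (suc j) y                                          ≡⟨ ∑<-suc j y ⟩
    ∑< j y + y j                                          ≡⟨ cong (_+ y j) (digitSum-digitValue y j (prefix< ∘ m<n⇒m<1+n)) ⟩
    digitSum j (digitValue y j) + y j                     ≡⟨ +-comm _ (y j) ⟩
    y j + digitSum j (digitValue y j)                     ≡⟨ digitSum-top j (y j) (prefix< (n<1+n j)) ⟨
    digitSum (suc j) (digitValue y j + y j * b[ suc j ])  ≡⟨ cong (λ x → digitSum (suc j) (digitValue y j + x)) (*-comm (y j) _) ⟩
    digitSum (suc j) (digitValue y j + b[ suc j ] * y j)  ≡⟨ cong (digitSum (suc j)) (∑<-suc j _) ⟨
    digitSum (suc j) (digitValue y (suc j))               ∎
    where open ≡-Reasoning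

  greedy-digitValue< : ∀ (y : ℕ → ℕ) K →
                       (∀ {j} → suc j < K → y j ≤ b) →
                       (∀ {i j} → 1 ≤ i → suc i < K → y i ≡ b → j < i → y j ≡ 0) →
                       ∀ {j} → j < K → digitValue y j < b[ suc j ]
  greedy-digitValue< y K ≤b b⇒0 {zero}  _     = z<s
  greedy-digitValue< y K ≤b b⇒0 {suc j} 1+j<K with y j ≟ b
  ... | yes yj≡b = s≤s (≤-reflexive (begin
    digitValue y (suc j)               ≡⟨ ∑<-suc j _ ⟩
    digitValue y j + b[ suc j ] * y j  ≡⟨ cong₂ _+_ (lower≡0 j 1+j<K yj≡b) (cong (b[ suc j ] *_) yj≡b) ⟩
    b[ suc j ] * b                     ≡⟨ *-comm b[ suc j ] b ⟩
    b * b[ suc j ]                     ∎))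
    where
    open ≡-Reasoning
    lower≡0 : ∀ i → suc i < K → y i ≡ b → digitValue y i ≡ 0
    lower≡0 zero    _     _    = refl
    lower≡0 (suc i) 2+i<K yi≡b = begin
      digitValue y (suc i)   ≡⟨ ∑<-cong (suc i) (λ {l} l<i → trans (cong (b[ suc l ] *_) (b⇒0 z<s 2+i<K yi≡b l<i)) (*-zeroʳ b[ suc l ])) ⟩
      ∑< (suc i) (λ _ → 0)   ≡⟨ ∑<-const (suc i) 0 ⟩
      suc i * 0              ≡⟨ *-zeroʳ (suc i) ⟩
      0                      ∎
  ... | no yj≢b = begin-strict
    digitValue y (suc j)               ≡⟨ ∑<-suc j _ ⟩
    digitValue y j + b[ suc j ] * y j  <⟨ +-monoˡ-< _ (greedy-digitValue< y K ≤b b⇒0 (<-trans (n<1+n j) 1+j<K)) ⟩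
    b[ suc j ] + b[ suc j ] * y j      ≡⟨ *-suc b[ suc j ] (y j) ⟨
    b[ suc j ] * suc (y j)             ≤⟨ *-monoʳ-≤ b[ suc j ] (≤∧≢⇒< (≤b 1+j<K) yj≢b) ⟩
    b[ suc j ] * b                     ≡⟨ *-comm b[ suc j ] b ⟩
    b * b[ suc j ]                     <⟨ n<1+n _ ⟩
    b[ suc (suc j) ]                   ∎
    where open ≤-Reasoning

  greedy-digitSum : ∀ m M (x : Fin (suc m) → ℕ) → IsGreedy b (suc m) M x → ΣFin x ≡ digitSum (suc m) M
  greedy-digitSum m M x (sum≡M , _ , ≤b , b⇒0) = begin
    ΣFin x                                   ≡⟨ ΣFin≡∑<-extend (λ _ v → v) x ⟩
    ∑< (suc m) y                             ≡⟨ digitSum-digitValue y (suc m) (greedy-digitValue< y (suc m) y≤b y-b⇒0) ⟩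
    digitSum (suc m) (digitValue y (suc m))  ≡⟨ cong (digitSum (suc m)) value≡M ⟩
    digitSum (suc m) M                       ∎
    where
    open ≡-Reasoning
    y = extend x
    value≡M : digitValue y (suc m) ≡ M
    value≡M = trans (sym (ΣFin≡∑<-extend (λ j v → b[ suc j ] * v) x)) sum≡M
    y≤b : ∀ {j} → suc j < suc m → y j ≤ b
    y≤b 1+j<k = extend-∀ x (λ j v → suc j < suc m → v ≤ b) ≤b (<-trans (n<1+n _) 1+j<k) 1+j<k
    y-b⇒0 : ∀ {i j} → 1 ≤ i → suc i < suc m → y i ≡ b → j < i → y j ≡ 0
    y-b⇒0 {i} 1≤i 1+i<k yi≡b j<i =
      extend-∀ x (λ j w → j < i → w ≡ 0)
        (λ j → extend-∀ x (λ i v → 1 ≤ i → suc i < suc m → v ≡ b → toℕ j < i → x j ≡ 0)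
                 (λ i → b⇒0 i j) (<-trans (n<1+n i) 1+i<k) 1≤i 1+i<k yi≡b)
        (<-trans j<i (<-trans (n<1+n i) 1+i<k)) j<i

module NumericalSemigroup (b-1 k-1 a d : ℕ) .{{_ : NonZero a}}
  (X : ℕ → Fin (suc k-1) → ℕ) (greedy : ∀ M → IsGreedy (suc b-1) (suc k-1) M (X M)) where

  open DigitSum b-1

  k c : ℕ
  k = suc k-1
  c = b-1 * a + d

  h : ℕ → ℕ
  h = digitSum k

  ΣX≡h : ∀ M → ΣFin (X M) ≡ h M
  ΣX≡h M = greedy-digitSum k-1 M (X M) (greedy M)

  genA≡ : ∀ i → genA a b d k i ≡ c * b[ toℕ i ] + a
  genA≡ i = trans (cong (λ z → z * a + b[ toℕ i ] * d) (b^≡b-1*b[]+1 (toℕ i))) (arith b-1 b[ toℕ i ] a d)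
    where
    arith : ∀ x β a d → (x * β + 1) * a + β * d ≡ (x * a + d) * β + a
    arith = solve-∀

  span≡ : ∀ e → ΣFin (λ i → e i * genA a b d k i) ≡ c * ΣFin (λ i → e i * b[ toℕ i ]) + a * ΣFin e
  span≡ e = trans (ΣFin-cong (λ i → cong (e i *_) (genA≡ i))) (ΣFin-linear c a e (λ i → b[ toℕ i ]))

  -- A representation by m generators has b-parts summing to M, and the greedy one uses the fewest.
  inSpan⇔ : ∀ y → InSpan (genA a b d k) y ⇔ (∃[ M ] ∃[ m ] h M ≤ m × y ≡ c * M + a * m)
  inSpan⇔ y = mk⇔ to from
    where
    to : InSpan (genA a b d k) y → ∃[ M ] ∃[ m ] h M ≤ m × y ≡ c * M + a * m
    to (e , Σ≡y) = _ , _ , digitSum-minimal k e toℕ toℕ≤pred[n] , trans (sym Σ≡y) (span≡ e)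
    from : (∃[ M ] ∃[ m ] h M ≤ m × y ≡ c * M + a * m) → InSpan (genA a b d k) y
    from (M , m , hM≤m , y≡) = e , trans (span≡ e) (trans (cong₂ (λ M′ m′ → c * M′ + a * m′) value≡M count≡m) (sym y≡))
      where
      e : Fin (suc k) → ℕ
      e fzero    = m ∸ h M
      e (fsuc i) = X M i
      value≡M : ΣFin (λ i → e i * b[ toℕ i ]) ≡ M
      value≡M = trans (cong₂ _+_ (*-zeroʳ (m ∸ h M)) (ΣFin-cong (λ i → *-comm (X M i) b[ suc (toℕ i) ])))
                      (proj₁ (greedy M))
      count≡m : ΣFin e ≡ m
      count≡m = trans (cong (m ∸ h M +_) (ΣX≡h M)) (m∸n+n≡m hM≤m)

  module Quotient {p n : ℕ} .{{_ : NonZero p}} .{{_ : NonZero n}} (a≡n*p : a ≡ n * p)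
    (a⊥d : Coprime a d) (1≤d : 1 ≤ d) (bound : b-1 * k-1 ≤ b-1 * a + (d ∸ 1)) where

    -- w r is the least element of ⟨A⟩/p congruent to c r modulo n.
    w : ℕ → ℕ
    w r = c * r + h (r * p) * n

    p⊥c : Coprime p c
    p⊥c = ∣⇒coprime-*+ b-1 a⊥d (divides n a≡n*p)

    n⊥c : Coprime n c
    n⊥c = ∣⇒coprime-*+ b-1 a⊥d (divides p (trans a≡n*p (*-comm n p)))

    K≤c : k-1 * b-1 + 1 ≤ c
    K≤c = begin
      k-1 * b-1 + 1            ≡⟨ cong (_+ 1) (*-comm k-1 b-1) ⟩
      b-1 * k-1 + 1            ≤⟨ +-monoˡ-≤ 1 bound ⟩
      b-1 * a + (d ∸ 1) + 1    ≡⟨ +-assoc (b-1 * a) (d ∸ 1) 1 ⟩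
      b-1 * a + (d ∸ 1 + 1)    ≡⟨ cong (b-1 * a +_) (m∸n+n≡m 1≤d) ⟩
      c                        ∎
      where open ≤-Reasoning

    -- Write p x = c M + a m and M = M₀ + t a with M₀ < a; coprimality forces M₀ = r p, and
    -- h M₀ ≤ h M + t (k - 1)(b - 1) + t ≤ m + c t, so x ≥ w r lies in the class of c r.
    inQuot⇔ : ∀ x → InQuot (genA a b d k) p x ⇔ (∃[ r ] r < n × ∃[ t ] x ≡ w r + n * t)
    inQuot⇔ x = mk⇔ to from
      where
      to : InQuot (genA a b d k) p x → ∃[ r ] r < n × ∃[ t ] x ≡ w r + n * t
      to x∈ with Equivalence.to (inSpan⇔ (p * x)) x∈
      ... | M , m , hM≤m , px≡ = r , r<n , c * t + m ∸ h (r * p) , x≡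
        where
        M₀ = M % a
        t = M / a
        M≡ : M ≡ M₀ + t * a
        M≡ = m≡m%n+[m/n]*n M a
        px≡′ : p * x ≡ a * (c * t + m) + c * M₀
        px≡′ = trans px≡ (trans (cong (λ M′ → c * M′ + a * m) M≡) (arith c M₀ t a m))
          where
          arith : ∀ c M₀ t a m → c * (M₀ + t * a) + a * m ≡ a * (c * t + m) + c * M₀
          arith = solve-∀
        p∣M₀ : p ∣ M₀
        p∣M₀ = coprime-divisor p⊥c (∣m+n∣m⇒∣n (subst (p ∣_) px≡′ (m∣m*n x))
                                              (∣-trans (divides n a≡n*p) (m∣m*n (c * t + m))))
        r = _∣_.quotient p∣M₀
        M₀≡r*p : M₀ ≡ r * p
        M₀≡r*p = _∣_.equality p∣M₀
        r<n : r < n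
        r<n = *-cancelʳ-< p r n (subst₂ _<_ M₀≡r*p a≡n*p (m%n<n M a))
        h-bound : h (r * p) ≤ c * t + m
        h-bound = begin
          h (r * p)                              ≡⟨ cong h M₀≡r*p ⟨
          h M₀                                   ≤⟨ digitSum-+* k-1 M₀ a t ⟩
          h (M₀ + t * a) + t * (k-1 * b-1 + 1)   ≡⟨ cong (λ M′ → h M′ + t * (k-1 * b-1 + 1)) M≡ ⟨
          h M + t * (k-1 * b-1 + 1)              ≤⟨ +-mono-≤ hM≤m (*-monoʳ-≤ t K≤c) ⟩
          m + t * c                              ≡⟨ +-comm m (t * c) ⟩
          t * c + m                              ≡⟨ cong (_+ m) (*-comm t c) ⟩
          c * t + m                              ∎
          where open ≤-Reasoning
        t′ = c * t + m ∸ h (r * p)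
        x≡ : x ≡ w r + n * t′
        x≡ = *-cancelˡ-≡ x _ p (begin
          p * x                                      ≡⟨ px≡′ ⟩
          a * (c * t + m) + c * M₀                   ≡⟨ cong₂ (λ a′ M′ → a′ * (c * t + m) + c * M′) a≡n*p M₀≡r*p ⟩
          n * p * (c * t + m) + c * (r * p)          ≡⟨ cong (λ s → n * p * s + c * (r * p)) (m+[n∸m]≡n h-bound) ⟨
          n * p * (h (r * p) + t′) + c * (r * p)     ≡⟨ arith n p (h (r * p)) t′ c r ⟩
          p * (w r + n * t′)                         ∎)
          where
          open ≡-Reasoning
          arith : ∀ n p h t′ c r → n * p * (h + t′) + c * (r * p) ≡ p * (c * r + h * n + n * t′)
          arith = solve-∀
      from : (∃[ r ] r < n × ∃[ t ] x ≡ w r + n * t) → InQuot (genA a b d k) p x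
      from (r , _ , t , x≡) = Equivalence.from (inSpan⇔ (p * x)) (r * p , h (r * p) + t , m≤m+n _ t , px≡)
        where
        arith : ∀ p c r h n t → p * (c * r + h * n + n * t) ≡ c * (r * p) + n * p * (h + t)
        arith = solve-∀
        px≡ : p * x ≡ c * (r * p) + a * (h (r * p) + t)
        px≡ = trans (cong (p *_) x≡) (trans (arith p c r (h (r * p)) n t)
                (cong (λ a′ → c * (r * p) + a′ * (h (r * p) + t)) (sym a≡n*p)))

    w%n≡ : ∀ r → w r % n ≡ (c * r) % n
    w%n≡ r = [m+kn]%n≡m%n (c * r) (h (r * p)) n

    hasGenus : HasGenus (InQuot (genA a b d k) p) (Σ1to (n ∸ 1) (λ r → w r / n))
    hasGenus = Apéry.hasGenus (InQuot (genA a b d k) p) w w0≡0 w-injective w-surjective inQuot⇔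
      where
      w0≡0 : w 0 ≡ 0
      w0≡0 = cong₂ _+_ (*-zeroʳ c) (cong (_* n) (digitSum-zero k))
      w-injective : ∀ {r r′} → r < n → r′ < n → w r % n ≡ w r′ % n → r ≡ r′
      w-injective r<n r′<n w≡w′ = *-injective-mod n⊥c r<n r′<n (trans (sym (w%n≡ _)) (trans w≡w′ (w%n≡ _)))
      w-surjective : ∀ x → ∃[ r ] r < n × w r % n ≡ x % n
      w-surjective x with *-surjective-mod n⊥c x
      ... | r , r<n , cr≡x = r , r<n , trans (w%n≡ r) cr≡x

    2*genus≡ : 2 * Σ1to (n ∸ 1) (λ r → w r / n) ≡
               2 * Σ1to (n ∸ 1) (λ r → ΣFin (X (r * p))) + (c ∸ 1) * (n ∸ 1)
    2*genus≡ = begin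
      2 * Σ1to (n ∸ 1) (λ r → w r / n)                               ≡⟨ cong (2 *_) (∑<-cong (n ∸ 1) w/n≡) ⟩
      2 * ∑< (n ∸ 1) (λ r → F (suc r) + H (suc r))                   ≡⟨ cong (2 *_) (∑<-distrib-+ (n ∸ 1) (F ∘ suc) (H ∘ suc)) ⟩
      2 * (Σ1to (n ∸ 1) F + Σ1to (n ∸ 1) H)                           ≡⟨ *-distribˡ-+ 2 (Σ1to (n ∸ 1) F) _ ⟩
      2 * Σ1to (n ∸ 1) F + 2 * Σ1to (n ∸ 1) H                        ≡⟨ +-comm (2 * Σ1to (n ∸ 1) F) _ ⟩
      2 * Σ1to (n ∸ 1) H + 2 * Σ1to (n ∸ 1) F                        ≡⟨ cong (2 * Σ1to (n ∸ 1) H +_) (2*∑⌊cr/n⌋≡[c∸1]*[n∸1] n⊥c) ⟩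
      2 * Σ1to (n ∸ 1) H + (c ∸ 1) * (n ∸ 1)                         ∎
      where
      open ≡-Reasoning
      F H : ℕ → ℕ
      F r = c * r / n
      H r = ΣFin (X (r * p))
      w/n≡ : ∀ {r} → r < n ∸ 1 → w (suc r) / n ≡ F (suc r) + H (suc r)
      w/n≡ {r} _ = begin
        w (suc r) / n                                   ≡⟨ +-distrib-/-∣ʳ (c * suc r) (divides-refl (h (suc r * p))) ⟩
        F (suc r) + h (suc r * p) * n / n               ≡⟨ cong (F (suc r) +_) (m*n/n≡m (h (suc r * p)) n) ⟩
        F (suc r) + h (suc r * p)                       ≡⟨ cong (F (suc r) +_) (ΣX≡h (suc r * p)) ⟨
        F (suc r) + H (suc r)                           ∎

corollary4p6 : (a k b d p : ℕ) → 2 ≤ a → 2 ≤ k → 2 ≤ b → 1 ≤ d → gcd a d ≡ 1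
    → .{{_ : NonZero p}} → p ∣ a → ¬ (p ≡ a)
    → (b ∸ 1) * (k ∸ 1) ≤ (b ∸ 1) * a + (d ∸ 1)
    → (X : ℕ → Fin k → ℕ) → (∀ M → IsGreedy b k M (X M))
    → Σ ℕ λ g → HasGenus (InQuot (genA a b d k) p) g
        × 2 * g ≡ 2 * Σ1to (a / p ∸ 1) (λ r → ΣFin (X (r * p)))
                  + ((b ∸ 1) * a + d ∸ 1) * (a / p ∸ 1)
corollary4p6 a@(suc _) (suc k-1) (suc b-1) d p _ _ _ 1≤d gcd≡1 p∣a _ bound X greedy =
  _ , hasGenus , 2*genus≡
  where
  instance
    a/p≢0 : NonZero (a / p)
    a/p≢0 = >-nonZero (m≥n⇒m/n>0 (∣⇒≤ p∣a))
  open NumericalSemigroup b-1 k-1 a d X greedy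
  open Quotient {p} {a / p} (sym (m/n*n≡m p∣a)) (gcd≡1⇒coprime gcd≡1) 1≤d bound
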